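{- Let $\mathcal{G}$ be an additive subgroup of $\mathbb{R}$, $n$ a positive integer, and $c,m\in\mathcal{G}$ with $c>0$, $m\geq 0$. Each equivalence class $T$ of the relation $\sim$ on $S$ contains exactly one Dyck vector.
   Context: An area vector is $g=(g_0,\ldots,g_{n-1})\in\mathcal{G}^n$ with $g_{i+1}\leq g_i+m$ for $0\leq i<n-1$; $\mathrm{AV}_n$ is the set of area vectors. A Dyck vector is an area vector all of whose entries are strictly positive. The cycling operator $C:\mathcal{G}^n\to\mathcal{G}^n$ is $C(g_0,\ldots,g_{n-1})=(g_1,\ldots,g_{n-1},g_0-c)$, a bijection with powers $C^j$, $j\in\mathbb{Z}$. $S=\{g\in\mathrm{AV}_n: g_0\leq c,\ g_{n-1}>0\}$, and for $g,h\in S$, $g\sim h$ iff $h=C^j(g)$ for some $j\in\mathbb{Z}$. -}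

module Defs where

open import Level using (0ℓ)
open import Data.Nat using (ℕ; zero; suc)
open import Data.Integer using (ℤ; +_; -[1+_])
open import Data.Product using (Σ; ∃; _×_; _,_)
open import Data.Sum using (_⊎_)
open import Data.Unit using (⊤)
open import Data.Vec using (Vec; []; _∷_; _∷ʳ_; head; last; init)
open import Data.Vec.Relation.Unary.All using (All)
open import Relation.Binary.PropositionalEquality using (_≡_)
open import Relation.Nullary using (¬_)

natMul : {A : Set} → (A → A → A) → A → ℕ → A → A
natMul _+_ z zero    x = z
natMul _+_ z (suc n) x = x + natMul _+_ z n x

-- A (totally) ordered abelian group which is archimedean.
-- By Hölder's theorem these are, up to order-isomorphism, exactly the
-- additive subgroups of ℝ (with the induced order).
record ArchOrderedAbGroup : Set₁ where
  infixl 6 _+_ _-_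
  infix 4 _≤_ _<_
  field
    Carrier : Set
    _+_     : Carrier → Carrier → Carrier
    0#      : Carrier
    -_      : Carrier → Carrier
    _≤_     : Carrier → Carrier → Set
    +-assoc   : ∀ x y z → (x + y) + z ≡ x + (y + z)
    +-comm    : ∀ x y → x + y ≡ y + x
    +-identityˡ : ∀ x → 0# + x ≡ x
    -‿inverseˡ : ∀ x → (- x) + x ≡ 0#
    ≤-refl    : ∀ x → x ≤ x
    ≤-trans   : ∀ {x y z} → x ≤ y → y ≤ z → x ≤ z
    ≤-antisym : ∀ {x y} → x ≤ y → y ≤ x → x ≡ y
    ≤-total   : ∀ x y → x ≤ y ⊎ y ≤ x
    +-mono-≤  : ∀ {x y} z → x ≤ y → x + z ≤ y + z

  _-_ : Carrier → Carrier → Carrier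
  x - y = x + (- y)

  _<_ : Carrier → Carrier → Set
  x < y = x ≤ y × ¬ (x ≡ y)

  _·ℕ_ : ℕ → Carrier → Carrier
  n ·ℕ x = natMul _+_ 0# n x

  field
    archimedean : ∀ x y → 0# < x → ∃ λ n → y ≤ n ·ℕ x

module AreaVectors (𝒢 : ArchOrderedAbGroup) (c m : ArchOrderedAbGroup.Carrier 𝒢) where
  open ArchOrderedAbGroup 𝒢

  IsAreaVector : ∀ {n} → Vec Carrier n → Set
  IsAreaVector []             = ⊤
  IsAreaVector (x ∷ [])       = ⊤
  IsAreaVector (x ∷ y ∷ ys)   = (y ≤ x + m) × IsAreaVector (y ∷ ys)

  IsDyck : ∀ {n} → Vec Carrier n → Set
  IsDyck g = IsAreaVector g × All (0# <_) g

  cyc : ∀ {n} → Vec Carrier (suc n) → Vec Carrier (suc n)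
  cyc (x ∷ xs) = xs ∷ʳ (x - c)

  cyc⁻¹ : ∀ {n} → Vec Carrier (suc n) → Vec Carrier (suc n)
  cyc⁻¹ xs = (last xs + c) ∷ init xs

  iter : ∀ {n} → (Vec Carrier n → Vec Carrier n) → ℕ → Vec Carrier n → Vec Carrier n
  iter f zero    g = g
  iter f (suc k) g = f (iter f k g)

  cycPow : ∀ {n} → ℤ → Vec Carrier (suc n) → Vec Carrier (suc n)
  cycPow (+ k)      g = iter cyc k g
  cycPow -[1+ k ]   g = iter cyc⁻¹ (suc k) g

  InS : ∀ {n} → Vec Carrier (suc n) → Set
  InS g = IsAreaVector g × (head g ≤ c) × (0# < last g)

  _∼_ : ∀ {n} → Vec Carrier (suc n) → Vec Carrier (suc n) → Set
  g ∼ h = ∃ λ (j : ℤ) → h ≡ cycPow j g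

-- A full turn of the cycling operator on vectors of length n subtracts c
-- from every entry: C^n g = g - c. So if g ∈ S and K is large enough
-- (archimedean property), w = g + K c is positive with C^{Kn} w = g. Cycling w
-- forward while its first entry exceeds c keeps it positive and stops, at the
-- latest at g, at a positive h with h_0 ≤ c; the wrap-around area condition
-- h_0 - c ≤ h_{n-1} + m is carried backwards along C from g to h, so h is a
-- Dyck vector in the class of g. Uniqueness: C h ends with h_0 - c ≤ 0, and
-- positivity of C^d h (d > 0) would force positivity of C h, because C only
-- lowers the entry it moves to the end.

module Submission where

open import Defs
open import Data.Nat using (ℕ; suc)
open import Data.Vec using (Vec)
open import Data.Product using (Σ; ∃; _×_; _,_)
open import Relation.Binary.PropositionalEquality using (_≡_)

open import Data.Nat using (zero; _*_; _⊔_; z≤n; s≤s)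
import Data.Nat as ℕ
import Data.Nat.Properties as ℕₚ
open import Data.Integer using (-[1+_])
import Data.Integer as ℤ
open import Data.Vec using ([]; _∷_; _∷ʳ_; head; last; init; initLast; toList)
import Data.Vec as Vec
import Data.Vec.Properties as Vecₚ
open import Data.Vec.Relation.Binary.Equality.Cast using (cast-is-id)
open import Data.Vec.Relation.Unary.All using (All; []; _∷_)
import Data.Vec.Relation.Unary.All as All
import Data.Vec.Relation.Unary.All.Properties as Allₚ
open import Data.List using ([]; _∷_; _++_; [_])
import Data.List as List
import Data.List.Properties as Listₚ
open import Data.Product using (proj₁; proj₂)
open import Data.Sum using (_⊎_; inj₁; inj₂)
open import Data.Unit using (tt)
open import Function using (case_of_)
open import Relation.Nullary using (¬_; contradiction)
open import Relation.Binary.PropositionalEquality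
  using (refl; sym; trans; cong; subst; subst₂; module ≡-Reasoning)

module _ {A : Set} {P : A → Set} where

  ∷ʳ⁺ : ∀ {n} {xs : Vec A n} {y} → All P xs → P y → All P (xs ∷ʳ y)
  ∷ʳ⁺ []         py = py ∷ []
  ∷ʳ⁺ (px ∷ pxs) py = px ∷ ∷ʳ⁺ pxs py

  ∷ʳ⁻ : ∀ {n} (xs : Vec A n) {y} → All P (xs ∷ʳ y) → All P xs × P y
  ∷ʳ⁻ []       (py ∷ [])  = [] , py
  ∷ʳ⁻ (x ∷ xs) (px ∷ pxs) = let pxs′ , py = ∷ʳ⁻ xs pxs in px ∷ pxs′ , py

  last⁺ : ∀ {n} {xs : Vec A (suc n)} → All P xs → P (last xs)
  last⁺ {xs = _ ∷ []}    (px ∷ [])  = px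
  last⁺ {xs = _ ∷ _ ∷ _} (_ ∷ pxs) = last⁺ pxs

module OrderedGroupProperties (𝒢 : ArchOrderedAbGroup) where
  open ArchOrderedAbGroup 𝒢

  +-identityʳ : ∀ x → x + 0# ≡ x
  +-identityʳ x = trans (+-comm x 0#) (+-identityˡ x)

  -‿inverseʳ : ∀ x → x - x ≡ 0#
  -‿inverseʳ x = trans (+-comm x (- x)) (-‿inverseˡ x)

  x-y+y≡x : ∀ x y → x - y + y ≡ x
  x-y+y≡x x y = trans (+-assoc x (- y) y) (trans (cong (x +_) (-‿inverseˡ y)) (+-identityʳ x))

  x+y-y≡x : ∀ x y → x + y - y ≡ x
  x+y-y≡x x y = trans (+-assoc x y (- y)) (trans (cong (x +_) (-‿inverseʳ y)) (+-identityʳ x))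

  x+[y+z]-y≡x+z : ∀ x y z → x + (y + z) - y ≡ x + z
  x+[y+z]-y≡x+z x y z = begin
    x + (y + z) - y   ≡⟨ +-assoc x (y + z) (- y) ⟩
    x + (y + z - y)   ≡⟨ cong (λ t → x + (t - y)) (+-comm y z) ⟩
    x + (z + y - y)   ≡⟨ cong (x +_) (x+y-y≡x z y) ⟩
    x + z             ∎
    where open ≡-Reasoning

  x-y+z≡x+z-y : ∀ x y z → x - y + z ≡ x + z - y
  x-y+z≡x+z-y x y z = begin
    x - y + z         ≡⟨ +-assoc x (- y) z ⟩
    x + (- y + z)     ≡⟨ cong (x +_) (+-comm (- y) z) ⟩
    x + (z - y)       ≡⟨ +-assoc x z (- y) ⟨
    x + z - y         ∎
    where open ≡-Reasoning

  +-cancelʳ-≡ : ∀ z {x y} → x + z ≡ y + z → x ≡ y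
  +-cancelʳ-≡ z {x} {y} eq = trans (sym (x+y-y≡x x z)) (trans (cong (_- z) eq) (x+y-y≡x y z))

  +-monoʳ-≤ : ∀ z {x y} → x ≤ y → z + x ≤ z + y
  +-monoʳ-≤ z {x} {y} x≤y = subst₂ _≤_ (+-comm x z) (+-comm y z) (+-mono-≤ z x≤y)

  +-cancelʳ-≤ : ∀ z {x y} → x + z ≤ y + z → x ≤ y
  +-cancelʳ-≤ z {x} {y} le = subst₂ _≤_ (x+y-y≡x x z) (x+y-y≡x y z) (+-mono-≤ (- z) le)

  +-monoˡ-< : ∀ z {x y} → x < y → x + z < y + z
  +-monoˡ-< z (x≤y , x≢y) = +-mono-≤ z x≤y , λ eq → x≢y (+-cancelʳ-≡ z eq)

  <-≤-trans : ∀ {x y z} → x < y → y ≤ z → x < z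
  <-≤-trans (x≤y , x≢y) y≤z = ≤-trans x≤y y≤z , λ { refl → x≢y (≤-antisym x≤y y≤z) }

  <⇒≱ : ∀ {x y} → x < y → ¬ y ≤ x
  <⇒≱ (x≤y , x≢y) y≤x = x≢y (≤-antisym x≤y y≤x)

  x≤y+x : ∀ {x y} → 0# ≤ y → x ≤ y + x
  x≤y+x {x} {y} 0≤y = subst (_≤ y + x) (+-identityˡ x) (+-mono-≤ x 0≤y)

  x≤x+y : ∀ {x y} → 0# ≤ y → x ≤ x + y
  x≤x+y {x} {y} 0≤y = subst (x ≤_) (+-comm y x) (x≤y+x 0≤y)

  0≤x⇒-x≤0 : ∀ {x} → 0# ≤ x → - x ≤ 0#
  0≤x⇒-x≤0 {x} 0≤x = subst₂ _≤_ (+-identityˡ (- x)) (-‿inverseʳ x) (+-mono-≤ (- x) 0≤x)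

  y<x⇒0<x-y : ∀ {x y} → y < x → 0# < x - y
  y<x⇒0<x-y {x} {y} y<x = subst (_< x - y) (-‿inverseʳ y) (+-monoˡ-< (- y) y<x)

  0<x-y⇒y<x : ∀ {x y} → 0# < x - y → y < x
  0<x-y⇒y<x {x} {y} 0<x-y = subst₂ _<_ (+-identityˡ y) (x-y+y≡x x y) (+-monoˡ-< y 0<x-y)

  -- ≤-total is a function, so for x ≡ y its two calls below coincide and
  -- cannot give different answers.
  ≤-<-total : ∀ x y → x ≤ y ⊎ y < x
  ≤-<-total x y with ≤-total x y in xy | ≤-total y x in yx
  ... | inj₁ x≤y | _        = inj₁ x≤y
  ... | inj₂ _   | inj₂ x≤y = inj₁ x≤y
  ... | inj₂ y≤x | inj₁ _   = inj₂ (y≤x , λ { refl → case trans (sym yx) xy of λ () })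

  0≤·ℕ : ∀ {x} → 0# ≤ x → ∀ K → 0# ≤ K ·ℕ x
  0≤·ℕ 0≤x zero    = ≤-refl 0#
  0≤·ℕ 0≤x (suc K) = ≤-trans (0≤·ℕ 0≤x K) (x≤y+x 0≤x)

  ·ℕ-monoˡ-≤ : ∀ {x} → 0# ≤ x → ∀ {K K′} → K ℕ.≤ K′ → K ·ℕ x ≤ K′ ·ℕ x
  ·ℕ-monoˡ-≤ 0≤x {K′ = K′} z≤n = 0≤·ℕ 0≤x K′
  ·ℕ-monoˡ-≤ {x} 0≤x (s≤s K≤K′) = +-monoʳ-≤ x (·ℕ-monoˡ-≤ 0≤x K≤K′)

  module _ {c} (0<c : 0# < c) where

    archimedean-≤ : ∀ x → ∃ λ K → c ≤ x + K ·ℕ c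
    archimedean-≤ x =
      let K , c-x≤Kc = archimedean c (c - x) 0<c
      in K , subst₂ _≤_ (x-y+y≡x c x) (+-comm (K ·ℕ c) x) (+-mono-≤ x c-x≤Kc)

    archimedean-≤-all : ∀ {n} (v : Vec Carrier n) → ∃ λ K → All (λ x → c ≤ x + K ·ℕ c) v
    archimedean-≤-all []      = 0 , []
    archimedean-≤-all (x ∷ v) =
      let K₁ , p  = archimedean-≤ x
          K₂ , ps = archimedean-≤-all v
      in K₁ ⊔ K₂ , raise (ℕₚ.m≤m⊔n K₁ K₂) p ∷ All.map (raise (ℕₚ.m≤n⊔m K₁ K₂)) ps
      where
      raise : ∀ {K K′ y} → K ℕ.≤ K′ → c ≤ y + K ·ℕ c → c ≤ y + K′ ·ℕ c
      raise {y = y} K≤K′ p = ≤-trans p (+-monoʳ-≤ y (·ℕ-monoˡ-≤ (proj₁ 0<c) K≤K′))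

module Cycling (𝒢 : ArchOrderedAbGroup) (c m : ArchOrderedAbGroup.Carrier 𝒢) where
  open ArchOrderedAbGroup 𝒢
  open OrderedGroupProperties 𝒢
  open AreaVectors 𝒢 c m

  private variable
    n : ℕ

  iter-comm : ∀ (f : Vec Carrier n → Vec Carrier n) k v → iter f k (f v) ≡ f (iter f k v)
  iter-comm f zero    v = refl
  iter-comm f (suc k) v = cong f (iter-comm f k v)

  iter-+ : ∀ (f : Vec Carrier n → Vec Carrier n) a b v → iter f (a ℕ.+ b) v ≡ iter f a (iter f b v)
  iter-+ f zero    b v = refl
  iter-+ f (suc a) b v = cong f (iter-+ f a b v)

  iter-inverse : ∀ {f g : Vec Carrier n → Vec Carrier n} → (∀ v → g (f v) ≡ v) →
                 ∀ k v → iter g k (iter f k v) ≡ v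
  iter-inverse         g∘f≡id zero    v = refl
  iter-inverse {f = f} {g} g∘f≡id (suc k) v = begin
    g (iter g k (f (iter f k v)))  ≡⟨ iter-comm g k _ ⟨
    iter g k (g (f (iter f k v)))  ≡⟨ cong (iter g k) (g∘f≡id _) ⟩
    iter g k (iter f k v)          ≡⟨ iter-inverse g∘f≡id k v ⟩
    v                              ∎
    where open ≡-Reasoning

  iter-reflects : ∀ {f : Vec Carrier n → Vec Carrier n} {P : Vec Carrier n → Set} →
                  (∀ v → P (f v) → P v) → ∀ k v → P (iter f k v) → P v
  iter-reflects         f-reflects zero    v p = p
  iter-reflects {f = f} {P} f-reflects (suc k) v p =
    f-reflects v (iter-reflects f-reflects k (f v) (subst P (sym (iter-comm f k v)) p))

  cyc⁻¹∘cyc : ∀ (v : Vec Carrier (suc n)) → cyc⁻¹ (cyc v) ≡ v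
  cyc⁻¹∘cyc (x ∷ xs) rewrite Vecₚ.last-∷ʳ (x - c) xs | Vecₚ.init-∷ʳ (x - c) xs =
    cong (_∷ xs) (x-y+y≡x x c)

  cyc∘cyc⁻¹ : ∀ (v : Vec Carrier (suc n)) → cyc (cyc⁻¹ v) ≡ v
  cyc∘cyc⁻¹ v = trans (cong (init v ∷ʳ_) (x+y-y≡x (last v) c)) (sym (proj₂ (proj₂ (initLast v))))

  toList-iter-cyc : ∀ xs ys (v : Vec Carrier (suc n)) → toList v ≡ xs ++ ys →
                    toList (iter cyc (List.length xs) v) ≡ ys ++ List.map (_- c) xs
  toList-iter-cyc []       ys v eq = trans eq (sym (Listₚ.++-identityʳ ys))
  toList-iter-cyc (x ∷ xs) ys (y ∷ v) eq with Listₚ.∷-injective eq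
  ... | refl , v≡xs++ys = begin
    toList (cyc (iter cyc (List.length xs) (x ∷ v)))  ≡⟨ cong toList (iter-comm cyc (List.length xs) (x ∷ v)) ⟨
    toList (iter cyc (List.length xs) (v ∷ʳ (x - c)))  ≡⟨ toList-iter-cyc xs (ys ++ [ x - c ]) _ rotated ⟩
    (ys ++ [ x - c ]) ++ List.map (_- c) xs            ≡⟨ Listₚ.++-assoc ys [ x - c ] _ ⟩
    ys ++ List.map (_- c) (x ∷ xs)                     ∎
    where
    open ≡-Reasoning
    rotated : toList (v ∷ʳ (x - c)) ≡ xs ++ (ys ++ [ x - c ])
    rotated = begin
      toList (v ∷ʳ (x - c))      ≡⟨ Vecₚ.toList-∷ʳ (x - c) v ⟩
      toList v ++ [ x - c ]      ≡⟨ cong (_++ [ x - c ]) v≡xs++ys ⟩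
      (xs ++ ys) ++ [ x - c ]    ≡⟨ Listₚ.++-assoc xs ys _ ⟩
      xs ++ (ys ++ [ x - c ])    ∎

  iter-cyc-full-turn : ∀ (v : Vec Carrier (suc n)) → iter cyc (suc n) v ≡ Vec.map (_- c) v
  iter-cyc-full-turn {n} v = trans (sym (cast-is-id refl _)) (Vecₚ.toList-injective refl _ _ (begin
    toList (iter cyc (suc n) v)                    ≡⟨ cong (λ k → toList (iter cyc k v)) (Vecₚ.length-toList v) ⟨
    toList (iter cyc (List.length (toList v)) v)  ≡⟨ toList-iter-cyc (toList v) [] v (sym (Listₚ.++-identityʳ _)) ⟩
    List.map (_- c) (toList v)                     ≡⟨ Vecₚ.toList-map (_- c) v ⟨
    toList (Vec.map (_- c) v)                      ∎))
    where open ≡-Reasoning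

  iter-cyc-shift : ∀ K (v : Vec Carrier (suc n)) → iter cyc (K * suc n) (Vec.map (_+ K ·ℕ c) v) ≡ v
  iter-cyc-shift zero v = trans (Vecₚ.map-cong +-identityʳ v) (Vecₚ.map-id v)
  iter-cyc-shift {n} (suc K) v = begin
    iter cyc (suc n ℕ.+ K * suc n) w          ≡⟨ cong (λ k → iter cyc k w) (ℕₚ.+-comm (suc n) (K * suc n)) ⟩
    iter cyc (K * suc n ℕ.+ suc n) w          ≡⟨ iter-+ cyc (K * suc n) (suc n) w ⟩
    iter cyc (K * suc n) (iter cyc (suc n) w) ≡⟨ cong (iter cyc (K * suc n)) (iter-cyc-full-turn w) ⟩
    iter cyc (K * suc n) (Vec.map (_- c) w)   ≡⟨ cong (iter cyc (K * suc n)) one-turn-less ⟩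
    iter cyc (K * suc n) (Vec.map (_+ K ·ℕ c) v)  ≡⟨ iter-cyc-shift K v ⟩
    v                                          ∎
    where
    open ≡-Reasoning
    w = Vec.map (_+ suc K ·ℕ c) v
    one-turn-less : Vec.map (_- c) w ≡ Vec.map (_+ K ·ℕ c) v
    one-turn-less = trans (sym (Vecₚ.map-∘ (_- c) (_+ suc K ·ℕ c) v))
                          (Vecₚ.map-cong (λ x → x+[y+z]-y≡x+z x c (K ·ℕ c)) v)

  _↝_ : Vec Carrier (suc n) → Vec Carrier (suc n) → Set
  u ↝ v = ∃ λ d → v ≡ iter cyc d u

  ↝⇒∼ : ∀ {u v : Vec Carrier (suc n)} → u ↝ v → v ∼ u
  ↝⇒∼         (zero  , v≡u) = ℤ.+ 0 , sym v≡u
  ↝⇒∼ {u = u} (suc d , v≡)  =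
    -[1+ d ] , trans (sym (iter-inverse {f = cyc} {cyc⁻¹} cyc⁻¹∘cyc (suc d) u)) (cong (iter cyc⁻¹ (suc d)) (sym v≡))

  iter-cyc⁻¹-comparable : ∀ p r (u : Vec Carrier (suc n)) →
                          u ↝ iter cyc⁻¹ p (iter cyc r u) ⊎ iter cyc⁻¹ p (iter cyc r u) ↝ u
  iter-cyc⁻¹-comparable zero    r       u = inj₁ (r , refl)
  iter-cyc⁻¹-comparable (suc p) zero    u = inj₂ (suc p , sym (iter-inverse {f = cyc⁻¹} {cyc} cyc∘cyc⁻¹ (suc p) u))
  iter-cyc⁻¹-comparable (suc p) (suc r) u =
    subst (λ v → u ↝ v ⊎ v ↝ u) (sym cancel) (iter-cyc⁻¹-comparable p r u)
    where
    open ≡-Reasoning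
    w = iter cyc r u
    cancel : iter cyc⁻¹ (suc p) (cyc w) ≡ iter cyc⁻¹ p w
    cancel = begin
      cyc⁻¹ (iter cyc⁻¹ p (cyc w))  ≡⟨ iter-comm cyc⁻¹ p (cyc w) ⟨
      iter cyc⁻¹ p (cyc⁻¹ (cyc w))  ≡⟨ cong (iter cyc⁻¹ p) (cyc⁻¹∘cyc w) ⟩
      iter cyc⁻¹ p w                ∎

  ∼-comparable : ∀ {u v w : Vec Carrier (suc n)} → u ↝ v → v ∼ w → u ↝ w ⊎ w ↝ u
  ∼-comparable {u = u} (r , v≡) (ℤ.+ q , w≡) =
    inj₁ (q ℕ.+ r , trans w≡ (trans (cong (iter cyc q) v≡) (sym (iter-+ cyc q r u))))
  ∼-comparable {u = u} (r , v≡) (-[1+ q ] , w≡) =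
    subst (λ w → u ↝ w ⊎ w ↝ u) (sym (trans w≡ (cong (iter cyc⁻¹ (suc q)) v≡)))
          (iter-cyc⁻¹-comparable (suc q) r u)

  Positive : Vec Carrier n → Set
  Positive = All (0# <_)

  Normal : Vec Carrier (suc n) → Set
  Normal v = head v ≤ c × Positive v

  -- The second component is the area condition between the entries g_{n-1}
  -- and g_0 - c that become adjacent in C g.
  Cyclic : Vec Carrier (suc n) → Set
  Cyclic v = IsAreaVector v × (head v - c ≤ last v + m)

  area-∷ʳ⁻ : ∀ x (xs : Vec Carrier n) y → IsAreaVector ((x ∷ xs) ∷ʳ y) →
             IsAreaVector (x ∷ xs) × y ≤ last (x ∷ xs) + m
  area-∷ʳ⁻ x []        y (y≤x+m , _) = tt , y≤x+m
  area-∷ʳ⁻ x (x′ ∷ xs) y (x′≤x+m , area) =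
    let area′ , y≤last+m = area-∷ʳ⁻ x′ xs y area in (x′≤x+m , area′) , y≤last+m

  module _ (0<c : 0# < c) where

    cyc-reflects-positive : ∀ (v : Vec Carrier (suc n)) → Positive (cyc v) → Positive v
    cyc-reflects-positive (x ∷ xs) pos =
      let pos-xs , 0<x-c = ∷ʳ⁻ xs pos in <-≤-trans 0<c (proj₁ (0<x-y⇒y<x 0<x-c)) ∷ pos-xs

    head≤c⇒¬positive-cyc : ∀ {v : Vec Carrier (suc n)} → head v ≤ c → ¬ Positive (cyc v)
    head≤c⇒¬positive-cyc {v = x ∷ xs} x≤c pos = <⇒≱ (0<x-y⇒y<x (proj₂ (∷ʳ⁻ xs pos))) x≤c

    ↝-positive⇒≡ : ∀ {u v : Vec Carrier (suc n)} → head u ≤ c → Positive v → u ↝ v → v ≡ u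
    ↝-positive⇒≡         head≤c pos (zero  , v≡u) = v≡u
    ↝-positive⇒≡ {u = u} head≤c pos (suc d , refl) =
      contradiction (iter-reflects {f = cyc} cyc-reflects-positive d (cyc u) pos-iter)
                    (head≤c⇒¬positive-cyc {v = u} head≤c)
      where pos-iter = subst Positive (sym (iter-comm cyc d u)) pos

    normal-unique : ∀ {u v w : Vec Carrier (suc n)} → Normal u → Normal w → u ↝ v → v ∼ w → w ≡ u
    normal-unique (head-u≤c , pos-u) (head-w≤c , pos-w) u↝v v∼w with ∼-comparable u↝v v∼w
    ... | inj₁ u↝w = ↝-positive⇒≡ head-u≤c pos-w u↝w
    ... | inj₂ w↝u = sym (↝-positive⇒≡ head-w≤c pos-u w↝u)

    normal-before : ∀ d (v : Vec Carrier (suc n)) → Positive v → head (iter cyc d v) ≤ c →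
                    ∃ λ h → Normal h × h ↝ iter cyc d v
    normal-before zero    v        pos head≤c = v , (head≤c , pos) , 0 , refl
    normal-before (suc d) (x ∷ xs) pos@(_ ∷ pos-xs) head≤c with ≤-<-total x c
    ... | inj₁ x≤c = x ∷ xs , (x≤c , pos) , suc d , refl
    ... | inj₂ c<x =
      let h , normal , h↝ = normal-before d (cyc (x ∷ xs)) (∷ʳ⁺ pos-xs (y<x⇒0<x-y c<x))
                              (subst (λ v → head v ≤ c) (sym commute) head≤c)
      in h , normal , subst (h ↝_) commute h↝
      where commute = iter-comm cyc d (x ∷ xs)

    ∃-normal-↝ : ∀ (g : Vec Carrier (suc n)) → head g ≤ c → ∃ λ h → Normal h × h ↝ g
    ∃-normal-↝ {n} g head≤c =
      let K , c≤ = archimedean-≤-all 0<c g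
          w      = Vec.map (_+ K ·ℕ c) g
          h , normal , h↝ = normal-before (K * suc n) w
                              (Allₚ.map⁺ (All.map (<-≤-trans 0<c) c≤))
                              (subst (λ v → head v ≤ c) (sym (iter-cyc-shift K g)) head≤c)
      in h , normal , subst (h ↝_) (iter-cyc-shift K g) h↝

    module _ (0≤m : 0# ≤ m) where

      cyc-reflects-cyclic : ∀ (v : Vec Carrier (suc n)) → Cyclic (cyc v) → Cyclic v
      cyc-reflects-cyclic (x ∷ []) _ = tt , +-monoʳ-≤ x (≤-trans (0≤x⇒-x≤0 (proj₁ 0<c)) 0≤m)
      cyc-reflects-cyclic (x ∷ y ∷ ys) (area , wrap) =
        let area′ , x-c≤last+m = area-∷ʳ⁻ y ys (x - c) area
            y-c≤x-c+m = subst (λ l → y - c ≤ l + m) (Vecₚ.last-∷ʳ (x - c) (y ∷ ys)) wrap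
        in (+-cancelʳ-≤ (- c) (subst (y - c ≤_) (x-y+z≡x+z-y x c m) y-c≤x-c+m) , area′) , x-c≤last+m

      S⇒cyclic : ∀ {g : Vec Carrier (suc n)} → InS g → Cyclic g
      S⇒cyclic {g = g} (area , head≤c , 0<last) =
        area , ≤-trans (subst (head g - c ≤_) (-‿inverseʳ c) (+-mono-≤ (- c) head≤c))
                       (≤-trans (proj₁ 0<last) (x≤x+y 0≤m))

      ↝-reflects-cyclic : ∀ {u v : Vec Carrier (suc n)} → u ↝ v → Cyclic v → Cyclic u
      ↝-reflects-cyclic {u = u} (d , refl) = iter-reflects {f = cyc} cyc-reflects-cyclic d u

lemma2p13 : (𝒢 : ArchOrderedAbGroup) (c m : ArchOrderedAbGroup.Carrier 𝒢) →
    ArchOrderedAbGroup._<_ 𝒢 (ArchOrderedAbGroup.0# 𝒢) c →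
    ArchOrderedAbGroup._≤_ 𝒢 (ArchOrderedAbGroup.0# 𝒢) m →
    (k : ℕ) → (g : Vec (ArchOrderedAbGroup.Carrier 𝒢) (suc k)) →
    AreaVectors.InS 𝒢 c m g →
    Σ (Vec (ArchOrderedAbGroup.Carrier 𝒢) (suc k)) λ h →
      (AreaVectors.InS 𝒢 c m h × AreaVectors._∼_ 𝒢 c m g h × AreaVectors.IsDyck 𝒢 c m h) ×
      ((h′ : Vec (ArchOrderedAbGroup.Carrier 𝒢) (suc k)) →
        AreaVectors.InS 𝒢 c m h′ → AreaVectors._∼_ 𝒢 c m g h′ →
        AreaVectors.IsDyck 𝒢 c m h′ → h′ ≡ h)
lemma2p13 𝒢 c m 0<c 0≤m k g g∈S@(_ , head≤c , _) =
  let h , normal-h@(head-h≤c , pos-h) , h↝g = ∃-normal-↝ 0<c g head≤c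
      area-h , _ = ↝-reflects-cyclic 0<c 0≤m h↝g (S⇒cyclic 0<c 0≤m g∈S)
  in h , ((area-h , head-h≤c , last⁺ pos-h) , ↝⇒∼ h↝g , (area-h , pos-h)) ,
     λ h′ (_ , head-h′≤c , _) g∼h′ (_ , pos-h′) →
       normal-unique 0<c normal-h (head-h′≤c , pos-h′) h↝g g∼h′
  where open Cycling 𝒢 c m
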